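{- Let $n\ge 2$, let $A$ be an $n\times n$ alternating sign matrix, and let $O$ be the ogog triangle corresponding to $A$. Let $H$ be the ogog triangle whose two-color pyramid is obtained from $\mathrm{pyr}(O)$ by swapping the colors of all cubes and moving each cube at position $(i,j,k)$ to position $(n-i,k,j)$. Then $H$ is the ogog triangle corresponding to the alternating sign matrix obtained from $A$ by reversing the order of its rows.
   Context: An $n\times n$ alternating sign matrix (ASM) is a matrix with entries in $\{0,1,-1\}$ such that each row and each column sums to $1$ and the nonzero entries in each row and each column alternate in sign. A gog triangle of size $n$ is an array of positive integers $G(i,j)$, $1\le j\le i\le n$, with $G(i,j)\le n-i+j$, $G(i,j)<G(i,j+1)$, $G(i,j)\ge G(i+1,j)$, and $G(i,j)\le G(i+1,j+1)$ whenever the entries are defined. The gog triangle corresponding to an ASM $A$: for each $i$, the sum of the first $i$ rows of $A$ is a $0$-$1$ vector with exactly $i$ ones, and row $i$ of $G$ lists the positions of these ones in increasing order. An ogog triangle of index $n$ is an array of nonnegative integers $O(i,j)$, $1\le j\le i\le n-1$, with $O(i,j)\le n-i$, $O(i,j)\le O(i,j+1)$, $O(i,j)\ge O(i+1,j)$, $O(i,j)\le O(i+1,j+1)+1$ whenever defined. The ogog triangle corresponding to the gog triangle $G$ (and to its ASM) is $O(i,j)=G(i,j)-j$ for $1\le j\le i\le n-1$. The two-color pyramid $\mathrm{pyr}(O)$ is the set of cube positions $(i,j,k)$ with $1\le j\le i\le n-1$, $1\le k\le n-i$, the cube at $(i,j,k)$ being white if $k\le O(i,j)$ and gray otherwise.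 (The color-swapped, repositioned pyramid described in the claim is always the pyramid of some ogog triangle.) -}

module Defs where

open import Data.Nat using (ℕ; zero; suc; _≤_; _<_; _∸_; _+_; _≤ᵇ_)
open import Data.Integer as ℤ using (ℤ; +_; -_)
open import Data.Bool using (if_then_else_)
open import Data.Product using (Σ; _×_)
open import Relation.Binary.PropositionalEquality using (_≡_; _≢_)
open import Relation.Nullary using (¬_)
open import Data.Sum using (_⊎_)

-- Conventions: all indices are 1-based natural numbers. Matrices and
-- triangles are total functions ℕ → ℕ → _, only the values at indices
-- inside the relevant range are ever inspected.

Matrix : Set
Matrix = ℕ → ℕ → ℤ

Triangle : Set
Triangle = ℕ → ℕ → ℕ

rsum : ℕ → (ℕ → ℤ) → ℤ
rsum zero    f = + 0
rsum (suc m) f = rsum m f ℤ.+ f (suc m)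

record IsASM (n : ℕ) (A : Matrix) : Set where
  field
    entries : ∀ i j → 1 ≤ i → i ≤ n → 1 ≤ j → j ≤ n →
              (A i j ≡ + 0) ⊎ (A i j ≡ + 1) ⊎ (A i j ≡ - (+ 1))
    rowSum  : ∀ i → 1 ≤ i → i ≤ n → rsum n (λ j → A i j) ≡ + 1
    colSum  : ∀ j → 1 ≤ j → j ≤ n → rsum n (λ i → A i j) ≡ + 1
    rowAlt  : ∀ i j j' → 1 ≤ i → i ≤ n → 1 ≤ j → j < j' → j' ≤ n →
              A i j ≢ + 0 → A i j' ≢ + 0 →
              (∀ m → j < m → m < j' → A i m ≡ + 0) →
              A i j' ≡ - A i j
    colAlt  : ∀ j i i' → 1 ≤ j → j ≤ n → 1 ≤ i → i < i' → i' ≤ n →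
              A i j ≢ + 0 → A i' j ≢ + 0 →
              (∀ m → i < m → m < i' → A m j ≡ + 0) →
              A i' j ≡ - A i j

partialRowSum : Matrix → ℕ → ℕ → ℤ
partialRowSum A i p = rsum i (λ r → A r p)

-- G is the gog triangle corresponding to A: G(i,j) is the position of the
-- j-th one (from the left) in the sum of the first i rows of A.
CorrGog : ℕ → Matrix → Triangle → Set
CorrGog n A G = ∀ i j → 1 ≤ j → j ≤ i → i ≤ n →
  (1 ≤ G i j) × (G i j ≤ n) ×
  (partialRowSum A i (G i j) ≡ + 1) ×
  (rsum (G i j) (λ p → partialRowSum A i p) ≡ + j)

CorrOgog : ℕ → Matrix → Triangle → Set
CorrOgog n A O = Σ Triangle λ G → CorrGog n A G ×
  (∀ i j → 1 ≤ j → j ≤ i → i ≤ n ∸ 1 → O i j ≡ G i j ∸ j)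

record IsOgog (n : ℕ) (O : Triangle) : Set where
  field
    bound : ∀ i j → 1 ≤ j → j ≤ i → i ≤ n ∸ 1 → O i j ≤ n ∸ i
    rowWeak : ∀ i j → 1 ≤ j → suc j ≤ i → i ≤ n ∸ 1 → O i j ≤ O i (suc j)
    colDown : ∀ i j → 1 ≤ j → j ≤ i → suc i ≤ n ∸ 1 → O (suc i) j ≤ O i j
    diagDown : ∀ i j → 1 ≤ j → j ≤ i → suc i ≤ n ∸ 1 → O i j ≤ O (suc i) (suc j) + 1

data Color : Set where
  white gray : Color

swapColor : Color → Color
swapColor white = gray
swapColor gray  = white

-- colour of the cube at (i,j,k) in pyr(O)
-- (only meaningful for 1 ≤ j ≤ i ≤ n-1, 1 ≤ k ≤ n-i)
pyrColor : Triangle → ℕ → ℕ → ℕ → Color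
pyrColor O i j k = if k ≤ᵇ O i j then white else gray

-- pyr(H) is obtained from pyr(O) by swapping all colours and moving the
-- cube at (i,j,k) to (n-i,k,j).  (This map is a bijection of the set of
-- cube positions onto itself, so equality of the pyramids amounts to this.)
PyrSwap : ℕ → Triangle → Triangle → Set
PyrSwap n O H = ∀ i j k → 1 ≤ j → j ≤ i → i ≤ n ∸ 1 → 1 ≤ k → k ≤ n ∸ i →
  pyrColor H (n ∸ i) k j ≡ swapColor (pyrColor O i j k)

revRows : ℕ → Matrix → Matrix
revRows n A i j = A (suc n ∸ i) j

-- Row i of the gog triangle of A lists the positions of the ones in the 0/1 vector of
-- partial column sums of the first i rows (0/1 because columns of an ASM alternate and sum
-- to 1). Reversing the rows replaces that vector for i rows by the complement of the one
-- for n - i rows of A. For complementary 0/1 vectors, the j-th one lies at or before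
-- (j - 1) + k exactly when the k-th zero lies after it: read through G(i,j) - j and
-- H(n-i,k) - k, this is the colour swap (i,j,k) ↦ (n-i,k,j). Complementation preserves
-- that consecutive count vectors interlace, which is all the ogog inequalities need.
module Submission where

open import Defs
open import Data.Nat using (ℕ; zero; suc; _≤_; _<_; _∸_; _+_; z≤n; s≤s; _≤?_; _≤ᵇ_; _≤′_; ≤′-refl; ≤′-step; s≤s⁻¹)
open import Data.Nat.Properties
open import Data.Integer as ℤ using (ℤ; +_; -_; ∣_∣)
import Data.Integer.Properties as ℤₚ
open import Data.Bool using (Bool; true; false; T; if_then_else_)
open import Data.Product using (Σ; _×_; _,_; proj₁; proj₂; map₂)
open import Data.Sum using (_⊎_; inj₁; inj₂) renaming (map to ⊎-map)
open import Relation.Nullary using (¬_; yes; no; contradiction)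
open import Relation.Nullary.Reflects using (ofʸ; ofⁿ)
open import Relation.Binary.PropositionalEquality
open import Algebra.Properties.CommutativeSemigroup +-commutativeSemigroup using () renaming (interchange to +-interchange)
open import Algebra.Properties.CommutativeSemigroup ℤₚ.+-commutativeSemigroup using () renaming (interchange to ℤ+-interchange)
open import Algebra.Bundles using (AbelianGroup)
open import Algebra.Properties.Group (AbelianGroup.group ℤₚ.+-0-abelianGroup) using (∙-cancelʳ)

Alternating : ℕ → (ℕ → ℤ) → Set
Alternating n f = ∀ a b → 1 ≤ a → a < b → b ≤ n → f a ≢ + 0 → f b ≢ + 0 →
  (∀ m → a < m → m < b → f m ≡ + 0) → f b ≡ - f a

-- e is the first nonzero value of f; every nonzero prefix sum equals it.
record AlternatingPrefix (f : ℕ → ℤ) (e : ℤ) (i : ℕ) : Set where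
  field
    last          : ℕ
    1≤last        : 1 ≤ last
    last≤i        : last ≤ i
    last≢0        : f last ≢ + 0
    zeroAfterLast : ∀ m → last < m → m ≤ i → f m ≡ + 0
    sumState      : (f last ≡ e × rsum i f ≡ e) ⊎ (f last ≡ - e × rsum i f ≡ + 0)

rsum-suc-zero : ∀ (f : ℕ → ℤ) i → f (suc i) ≡ + 0 → rsum (suc i) f ≡ rsum i f
rsum-suc-zero f i fi≡0 = trans (cong (λ x → rsum i f ℤ.+ x) fi≡0) (ℤₚ.+-identityʳ _)

module _ {n : ℕ} {f : ℕ → ℤ} (alt : Alternating n f) where

  lastAt : ∀ {e i} → f (suc i) ≢ + 0 →
           (f (suc i) ≡ e × rsum (suc i) f ≡ e) ⊎ (f (suc i) ≡ - e × rsum (suc i) f ≡ + 0) →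
           AlternatingPrefix f e (suc i)
  lastAt {i = i} fi≢0 state = record
    { last = suc i ; 1≤last = s≤s z≤n ; last≤i = ≤-refl ; last≢0 = fi≢0
    ; zeroAfterLast = λ m i<m m≤i → contradiction (≤-trans i<m m≤i) (n≮n (suc i))
    ; sumState = state }

  stepPrefix : ∀ {e i} → suc i ≤ n → AlternatingPrefix f e i → AlternatingPrefix f e (suc i)
  stepPrefix {e} {i} si≤n P with f (suc i) ℤ.≟ + 0
  ... | yes fi≡0 = record
    { last = last ; 1≤last = 1≤last ; last≢0 = last≢0
    ; last≤i = ≤-trans last≤i (n≤1+n i)
    ; zeroAfterLast = zeroAfter
    ; sumState = ⊎-map (map₂ extend) (map₂ extend) sumState }
    where
      open AlternatingPrefix P
      extend : ∀ {s} → rsum i f ≡ s → rsum (suc i) f ≡ s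
      extend = trans (rsum-suc-zero f i fi≡0)
      zeroAfter : ∀ m → last < m → m ≤ suc i → f m ≡ + 0
      zeroAfter m last<m m≤si with m≤n⇒m<n∨m≡n m≤si
      ... | inj₁ m<si = zeroAfterLast m last<m (s≤s⁻¹ m<si)
      ... | inj₂ refl = fi≡0
  ... | no fi≢0 = lastAt fi≢0 (flipState sumState)
    where
      open AlternatingPrefix P
      fi≡-last : f (suc i) ≡ - f last
      fi≡-last = alt last (suc i) 1≤last (s≤s last≤i) si≤n last≢0 fi≢0
                   (λ m last<m m<si → zeroAfterLast m last<m (s≤s⁻¹ m<si))
      flipState : (f last ≡ e × rsum i f ≡ e) ⊎ (f last ≡ - e × rsum i f ≡ + 0) →
                  (f (suc i) ≡ e × rsum (suc i) f ≡ e) ⊎ (f (suc i) ≡ - e × rsum (suc i) f ≡ + 0)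
      flipState (inj₁ (last≡e , sum≡e)) = inj₂ (fi≡-e , trans (cong₂ ℤ._+_ sum≡e fi≡-e) (ℤₚ.+-inverseʳ e))
        where fi≡-e = trans fi≡-last (cong -_ last≡e)
      flipState (inj₂ (last≡-e , sum≡0)) = inj₁ (fi≡e , trans (cong₂ ℤ._+_ sum≡0 fi≡e) (ℤₚ.+-identityˡ e))
        where fi≡e = trans fi≡-last (trans (cong -_ last≡-e) (ℤₚ.neg-involutive e))

  prefixState : ∀ i → i ≤ n → rsum i f ≡ + 0 ⊎ Σ ℤ (λ e → AlternatingPrefix f e i)
  prefixState zero _ = inj₁ refl
  prefixState (suc i) si≤n with prefixState i (≤-trans (n≤1+n i) si≤n)
  ... | inj₂ (e , P) = inj₂ (e , stepPrefix si≤n P)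
  ... | inj₁ sum≡0 with f (suc i) ℤ.≟ + 0
  ...   | yes fi≡0 = inj₁ (trans (rsum-suc-zero f i fi≡0) sum≡0)
  ...   | no fi≢0 = inj₂ (f (suc i) , lastAt fi≢0
                      (inj₁ (refl , trans (cong (λ x → x ℤ.+ f (suc i)) sum≡0) (ℤₚ.+-identityˡ _))))

  extendPrefix : ∀ {e i j} → i ≤′ j → j ≤ n → AlternatingPrefix f e i → AlternatingPrefix f e j
  extendPrefix ≤′-refl _ P = P
  extendPrefix (≤′-step i≤′j) sj≤n P = stepPrefix sj≤n (extendPrefix i≤′j (≤-trans (n≤1+n _) sj≤n) P)

  alternating-prefixSum-binary : rsum n f ≡ + 1 → ∀ i → i ≤ n → rsum i f ≡ + 0 ⊎ rsum i f ≡ + 1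
  alternating-prefixSum-binary total i i≤n with prefixState i i≤n
  ... | inj₁ sum≡0 = inj₁ sum≡0
  ... | inj₂ (e , P) with AlternatingPrefix.sumState P
                        | AlternatingPrefix.sumState (extendPrefix (≤⇒≤′ i≤n) ≤-refl P)
  ...   | inj₂ (_ , sum≡0) | _ = inj₁ sum≡0
  ...   | inj₁ (_ , sum≡e) | inj₁ (_ , total≡e) = inj₂ (trans sum≡e (trans (sym total≡e) total))
  ...   | inj₁ _ | inj₂ (_ , total≡0) with trans (sym total) total≡0
  ...     | ()

nsum : ℕ → (ℕ → ℕ) → ℕ
nsum zero    b = 0
nsum (suc m) b = nsum m b + b (suc m)

Binary : ℕ → (ℕ → ℕ) → Set
Binary n b = ∀ p → 1 ≤ p → p ≤ n → b p ≤ 1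

nsum-mono : ∀ b {m m'} → m ≤ m' → nsum m b ≤ nsum m' b
nsum-mono b m≤m' = go (≤⇒≤′ m≤m')
  where
    go : ∀ {m m'} → m ≤′ m' → nsum m b ≤ nsum m' b
    go ≤′-refl      = ≤-refl
    go (≤′-step le) = ≤-trans (go le) (m≤m+n _ _)

nsum-lipschitz : ∀ {n b} → Binary n b → ∀ {m m'} → m ≤ m' → m' ≤ n → nsum m' b ≤ nsum m b + (m' ∸ m)
nsum-lipschitz {n} {b} bin {m} {m'} m≤m' m'≤n =
  subst (λ x → nsum x b ≤ nsum m b + (m' ∸ m)) (m∸n+n≡m m≤m')
        (go (m' ∸ m) (subst (_≤ n) (sym (m∸n+n≡m m≤m')) m'≤n))
  where
    go : ∀ d → d + m ≤ n → nsum (d + m) b ≤ nsum m b + d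
    go zero    _     = ≤-reflexive (sym (+-identityʳ (nsum m b)))
    go (suc d) sd≤n  = begin
      nsum (d + m) b + b (suc (d + m)) ≤⟨ +-mono-≤ (go d (≤-trans (n≤1+n _) sd≤n)) (bin _ (s≤s z≤n) sd≤n) ⟩
      nsum m b + d + 1                 ≡⟨ +-assoc (nsum m b) d 1 ⟩
      nsum m b + (d + 1)               ≡⟨ cong (λ x → nsum m b + x) (+-comm d 1) ⟩
      nsum m b + suc d                 ∎
      where open ≤-Reasoning

nsum-≤ : ∀ {n b} → Binary n b → ∀ {m} → m ≤ n → nsum m b ≤ m
nsum-≤ bin m≤n = nsum-lipschitz bin z≤n m≤n

nsum-<-before-one : ∀ b {m} g → b g ≡ 1 → m < g → nsum m b < nsum g b
nsum-<-before-one b {m} (suc g) bg≡1 (s≤s m≤g) =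
  subst (nsum m b <_) (trans (+-comm 1 _) (cong (λ x → nsum g b + x) (sym bg≡1))) (s≤s (nsum-mono b m≤g))

record IsKth (n : ℕ) (b : ℕ → ℕ) (k g : ℕ) : Set where
  field
    1≤pos   : 1 ≤ g
    pos≤n   : g ≤ n
    isOne   : b g ≡ 1
    countAt : nsum g b ≡ k

module _ {n b k g} (P : IsKth n b k g) where
  open IsKth P

  isKth-≤⇒≤nsum : ∀ {m} → g ≤ m → k ≤ nsum m b
  isKth-≤⇒≤nsum {m} g≤m = subst (_≤ nsum m b) countAt (nsum-mono b g≤m)

  isKth-≤nsum⇒≤ : ∀ {m} → k ≤ nsum m b → g ≤ m
  isKth-≤nsum⇒≤ {m} k≤ = ≮⇒≥ λ m<g → <⇒≱ (subst (nsum m b <_) countAt (nsum-<-before-one b g isOne m<g)) k≤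

-- the least m ≤ N with k ≤ F m, or N if there is none
leastReaching : (ℕ → ℕ) → ℕ → ℕ → ℕ
leastReaching F k zero    = zero
leastReaching F k (suc N) with k ≤? F (leastReaching F k N)
... | yes _ = leastReaching F k N
... | no  _ = suc N

leastReaching-spec : ∀ F k N →
  leastReaching F k N ≤ N ×
  (∀ q → q < leastReaching F k N → F q < k) ×
  (k ≤ F (leastReaching F k N) ⊎ leastReaching F k N ≡ N)
leastReaching-spec F k zero = z≤n , (λ _ ()) , inj₂ refl
leastReaching-spec F k (suc N) with k ≤? F (leastReaching F k N) | leastReaching-spec F k N
... | yes reached | ≤N , below , _         = ≤-trans ≤N (n≤1+n N) , below , inj₁ reached
... | no  missed  | _  , _     , inj₁ reached = contradiction reached missed
... | no  missed  | _  , below , inj₂ ≡N  = ≤-refl , below' , inj₂ refl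
  where
    below' : ∀ q → q < suc N → F q < k
    below' q q<sN with m≤n⇒m<n∨m≡n (s≤s⁻¹ q<sN)
    ... | inj₁ q<N  = below q (subst (q <_) (sym ≡N) q<N)
    ... | inj₂ refl = ≰⇒> (subst (λ x → ¬ k ≤ F x) ≡N missed)

kth : ℕ → (ℕ → ℕ) → ℕ → ℕ
kth n b k = leastReaching (λ m → nsum m b) k n

crossing-step : ∀ {x k y} → x < k → k ≤ x + y → y ≤ 1 → y ≡ 1 × x + y ≡ k
crossing-step {x} {y = zero}     x<k k≤x _ = contradiction (subst (_ ≤_) (+-identityʳ x) k≤x) (<⇒≱ x<k)
crossing-step {x} {k} {suc zero} x<k k≤x _ = refl , ≤-antisym (subst (_≤ k) (+-comm 1 x) x<k) k≤x
crossing-step {y = suc (suc _)}  _   _   (s≤s ())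

kth-isKth : ∀ {n b k} → Binary n b → 1 ≤ k → k ≤ nsum n b → IsKth n b k (kth n b k)
kth-isKth {n} {b} {k} bin 1≤k k≤total with leastReaching-spec (λ m → nsum m b) k n
... | ≤n , below , reach = found (kth n b k) ≤n below (reaches reach)
  where
    reaches : k ≤ nsum (kth n b k) b ⊎ kth n b k ≡ n → k ≤ nsum (kth n b k) b
    reaches (inj₁ reached) = reached
    reaches (inj₂ ≡n)      = subst (λ x → k ≤ nsum x b) (sym ≡n) k≤total
    found : ∀ g → g ≤ n → (∀ q → q < g → nsum q b < k) → k ≤ nsum g b → IsKth n b k g
    found zero    _   _     k≤0 = contradiction (≤-trans 1≤k k≤0) λ ()
    found (suc g) g≤n below k≤ = record
      { 1≤pos = s≤s z≤n ; pos≤n = g≤n ; isOne = proj₁ crossing ; countAt = proj₂ crossing }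
      where crossing = crossing-step (below g ≤-refl) k≤ (bin (suc g) (s≤s z≤n) g≤n)

record Interlacing (n : ℕ) (b : ℕ → ℕ → ℕ) : Set where
  field
    binary    : ∀ i → i ≤ n → Binary n (b i)
    total     : ∀ i → i ≤ n → nsum n (b i) ≡ i
    interlace : ∀ i m → suc i ≤ n → m ≤ n →
                nsum m (b (suc i)) ≡ nsum m (b i) ⊎ nsum m (b (suc i)) ≡ suc (nsum m (b i))

gogOf : ℕ → (ℕ → ℕ → ℕ) → Triangle
gogOf n b i k = kth n (b i) k

ogogOf : ℕ → (ℕ → ℕ → ℕ) → Triangle
ogogOf n b i k = gogOf n b i k ∸ k

≤∸1⇒≤ : ∀ {i n} → i ≤ n ∸ 1 → i ≤ n
≤∸1⇒≤ {n = n} i≤ = ≤-trans i≤ (m∸n≤m n 1)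

module _ {n b} (I : Interlacing n b) where
  open Interlacing I

  gogOf-isKth : ∀ {i k} → 1 ≤ k → k ≤ i → i ≤ n → IsKth n (b i) k (gogOf n b i k)
  gogOf-isKth {i} 1≤k k≤i i≤n = kth-isKth (binary i i≤n) 1≤k (subst (_ ≤_) (sym (total i i≤n)) k≤i)

  nsum-interlace-≤ : ∀ {i m} → suc i ≤ n → m ≤ n → nsum m (b i) ≤ nsum m (b (suc i))
  nsum-interlace-≤ {i} {m} si≤n m≤n with interlace i m si≤n m≤n
  ... | inj₁ same = ≤-reflexive (sym same)
  ... | inj₂ next = ≤-trans (n≤1+n _) (≤-reflexive (sym next))

  nsum-interlace-≤suc : ∀ {i m} → suc i ≤ n → m ≤ n → nsum m (b (suc i)) ≤ suc (nsum m (b i))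
  nsum-interlace-≤suc {i} {m} si≤n m≤n with interlace i m si≤n m≤n
  ... | inj₁ same = ≤-trans (≤-reflexive same) (n≤1+n _)
  ... | inj₂ next = ≤-reflexive next

  ogogOf-bound : ∀ i k → 1 ≤ k → k ≤ i → i ≤ n ∸ 1 → ogogOf n b i k ≤ n ∸ i
  ogogOf-bound i k 1≤k k≤i i≤n-1 = m+n≤o⇒m≤o∸n (g ∸ k) (begin
      g ∸ k + i               ≤⟨ +-monoʳ-≤ (g ∸ k) i≤k+[n∸g] ⟩
      g ∸ k + (k + (n ∸ g))   ≡⟨ +-assoc (g ∸ k) k (n ∸ g) ⟨
      g ∸ k + k + (n ∸ g)     ≡⟨ cong (_+ (n ∸ g)) (m∸n+n≡m k≤g) ⟩
      g + (n ∸ g)             ≡⟨ m+[n∸m]≡n pos≤n ⟩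
      n                       ∎)
    where
      open ≤-Reasoning
      i≤n = ≤∸1⇒≤ i≤n-1
      g = gogOf n b i k
      open IsKth (gogOf-isKth 1≤k k≤i i≤n)
      k≤g : k ≤ g
      k≤g = subst (_≤ g) countAt (nsum-≤ (binary i i≤n) pos≤n)
      i≤k+[n∸g] : i ≤ k + (n ∸ g)
      i≤k+[n∸g] = subst₂ (λ x y → x ≤ y + (n ∸ g)) (total i i≤n) countAt
                    (nsum-lipschitz (binary i i≤n) pos≤n ≤-refl)

  ogogOf-rowWeak : ∀ i k → 1 ≤ k → suc k ≤ i → i ≤ n ∸ 1 → ogogOf n b i k ≤ ogogOf n b i (suc k)
  ogogOf-rowWeak i k 1≤k sk≤i i≤n-1 = ∸-monoˡ-≤ (suc k) (≰⇒> g₂≰g₁)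
    where
      i≤n = ≤∸1⇒≤ i≤n-1
      P₁ = gogOf-isKth 1≤k (≤-trans (n≤1+n k) sk≤i) i≤n
      P₂ = gogOf-isKth (s≤s z≤n) sk≤i i≤n
      g₂≰g₁ : ¬ gogOf n b i (suc k) ≤ gogOf n b i k
      g₂≰g₁ g₂≤g₁ = 1+n≰n (subst (suc k ≤_) (IsKth.countAt P₁) (isKth-≤⇒≤nsum P₂ g₂≤g₁))

  ogogOf-colDown : ∀ i k → 1 ≤ k → k ≤ i → suc i ≤ n ∸ 1 → ogogOf n b (suc i) k ≤ ogogOf n b i k
  ogogOf-colDown i k 1≤k k≤i si≤n-1 = ∸-monoˡ-≤ k (isKth-≤nsum⇒≤ P'
      (subst (_≤ nsum g (b (suc i))) countAt (nsum-interlace-≤ si≤n pos≤n)))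
    where
      si≤n = ≤∸1⇒≤ si≤n-1
      g = gogOf n b i k
      open IsKth (gogOf-isKth 1≤k k≤i (≤-trans (n≤1+n i) si≤n))
      P' = gogOf-isKth 1≤k (≤-trans k≤i (n≤1+n i)) si≤n

  ogogOf-diagDown : ∀ i k → 1 ≤ k → k ≤ i → suc i ≤ n ∸ 1 → ogogOf n b i k ≤ ogogOf n b (suc i) (suc k) + 1
  ogogOf-diagDown i k 1≤k k≤i si≤n-1 = begin
      gogOf n b i k ∸ k  ≤⟨ ∸-monoˡ-≤ k g≤g'' ⟩
      g'' ∸ k            ≡⟨ +-∸-assoc 1 sk≤g'' ⟩
      suc (g'' ∸ suc k)  ≡⟨ +-comm 1 _ ⟩
      g'' ∸ suc k + 1    ∎
    where
      open ≤-Reasoning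
      si≤n = ≤∸1⇒≤ si≤n-1
      i≤n = ≤-trans (n≤1+n i) si≤n
      g'' = gogOf n b (suc i) (suc k)
      open IsKth (gogOf-isKth (s≤s z≤n) (s≤s k≤i) si≤n)
      sk≤g'' : suc k ≤ g''
      sk≤g'' = subst (_≤ g'') countAt (nsum-≤ (binary (suc i) si≤n) pos≤n)
      g≤g'' : gogOf n b i k ≤ g''
      g≤g'' = isKth-≤nsum⇒≤ (gogOf-isKth 1≤k k≤i i≤n)
                (s≤s⁻¹ (subst (_≤ suc (nsum g'' (b i))) countAt (nsum-interlace-≤suc si≤n pos≤n)))

  interlacing-isOgog : IsOgog n (ogogOf n b)
  interlacing-isOgog = record
    { bound = ogogOf-bound ; rowWeak = ogogOf-rowWeak ; colDown = ogogOf-colDown ; diagDown = ogogOf-diagDown }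

complement : ℕ → (ℕ → ℕ → ℕ) → ℕ → ℕ → ℕ
complement n b i p = 1 ∸ b (n ∸ i) p

nsum-complement : ∀ {n c} → Binary n c → ∀ {m} → m ≤ n → nsum m (λ p → 1 ∸ c p) + nsum m c ≡ m
nsum-complement bin {zero}  _    = refl
nsum-complement {c = c} bin {suc m} sm≤n = begin
    (X + (1 ∸ c (suc m))) + (Y + c (suc m)) ≡⟨ +-interchange X (1 ∸ c (suc m)) Y (c (suc m)) ⟩
    (X + Y) + ((1 ∸ c (suc m)) + c (suc m)) ≡⟨ cong₂ _+_ (nsum-complement bin (≤-trans (n≤1+n m) sm≤n))
                                                        (m∸n+n≡m (bin (suc m) (s≤s z≤n) sm≤n)) ⟩
    m + 1                                   ≡⟨ +-comm m 1 ⟩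
    suc m                                   ∎
  where
    open ≡-Reasoning
    X = nsum m (λ p → 1 ∸ c p)
    Y = nsum m c

n∸i≡suc[n∸suc[i]] : ∀ {n i} → suc i ≤ n → n ∸ i ≡ suc (n ∸ suc i)
n∸i≡suc[n∸suc[i]] = +-∸-assoc 1

module _ {n b} (I : Interlacing n b) where
  open Interlacing I

  nsum-complement-+ : ∀ i m → i ≤ n → m ≤ n → nsum m (complement n b i) + nsum m (b (n ∸ i)) ≡ m
  nsum-complement-+ i m i≤n m≤n = nsum-complement (binary (n ∸ i) (m∸n≤m n i)) m≤n

  complement-total : ∀ i → i ≤ n → nsum n (complement n b i) ≡ i
  complement-total i i≤n = +-cancelʳ-≡ (n ∸ i) _ _ (begin
    nsum n (complement n b i) + (n ∸ i)            ≡⟨ cong (λ x → nsum n (complement n b i) + x) (total (n ∸ i) (m∸n≤m n i)) ⟨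
    nsum n (complement n b i) + nsum n (b (n ∸ i)) ≡⟨ nsum-complement-+ i n i≤n ≤-refl ⟩
    n                                              ≡⟨ m+[n∸m]≡n i≤n ⟨
    i + (n ∸ i)                                    ∎)
    where open ≡-Reasoning

  complement-interlace : ∀ i m → suc i ≤ n → m ≤ n →
    nsum m (complement n b (suc i)) ≡ nsum m (complement n b i) ⊎
    nsum m (complement n b (suc i)) ≡ suc (nsum m (complement n b i))
  complement-interlace i m si≤n m≤n = complementStep (interlace t m (subst (_≤ n) n∸i≡ (m∸n≤m n i)) m≤n)
    where
      open ≡-Reasoning
      t = n ∸ suc i
      X = nsum m (complement n b i)
      X' = nsum m (complement n b (suc i))
      n∸i≡ : n ∸ i ≡ suc t
      n∸i≡ = n∸i≡suc[n∸suc[i]] si≤n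
      before : X + nsum m (b (suc t)) ≡ m
      before = subst (λ s → X + nsum m (b s) ≡ m) n∸i≡ (nsum-complement-+ i m (≤-trans (n≤1+n i) si≤n) m≤n)
      after : X' + nsum m (b t) ≡ m
      after = nsum-complement-+ (suc i) m si≤n m≤n
      complementStep : nsum m (b (suc t)) ≡ nsum m (b t) ⊎ nsum m (b (suc t)) ≡ suc (nsum m (b t)) →
                       X' ≡ X ⊎ X' ≡ suc X
      complementStep (inj₁ same) = inj₁ (+-cancelʳ-≡ _ _ _ (trans after (sym (begin
        X + nsum m (b t)       ≡⟨ cong (λ x → X + x) same ⟨
        X + nsum m (b (suc t)) ≡⟨ before ⟩
        m                      ∎))))
      complementStep (inj₂ next) = inj₂ (+-cancelʳ-≡ _ _ _ (trans after (sym (begin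
        suc X + nsum m (b t)   ≡⟨ +-suc X _ ⟨
        X + suc (nsum m (b t)) ≡⟨ cong (λ x → X + x) next ⟨
        X + nsum m (b (suc t)) ≡⟨ before ⟩
        m                      ∎))))

  interlacing-complement : Interlacing n (complement n b)
  interlacing-complement = record
    { binary    = λ i _ p _ _ → m∸n≤m 1 (b (n ∸ i) p)
    ; total     = complement-total
    ; interlace = complement-interlace }

rsum-+ : ∀ m (f g : ℕ → ℤ) → rsum m (λ p → f p ℤ.+ g p) ≡ rsum m f ℤ.+ rsum m g
rsum-+ zero    f g = refl
rsum-+ (suc m) f g = trans (cong (λ x → x ℤ.+ (f (suc m) ℤ.+ g (suc m))) (rsum-+ m f g))
                           (ℤ+-interchange (rsum m f) (rsum m g) (f (suc m)) (g (suc m)))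

rsum-const0 : ∀ m → rsum m (λ _ → + 0) ≡ + 0
rsum-const0 zero    = refl
rsum-const0 (suc m) = trans (ℤₚ.+-identityʳ _) (rsum-const0 m)

rsum≡nsum : ∀ m {u : ℕ → ℤ} {b : ℕ → ℕ} → (∀ p → 1 ≤ p → p ≤ m → u p ≡ + b p) → rsum m u ≡ + nsum m b
rsum≡nsum zero    _ = refl
rsum≡nsum (suc m) u≡b = cong₂ ℤ._+_ (rsum≡nsum m λ p 1≤p p≤m → u≡b p 1≤p (≤-trans p≤m (n≤1+n m)))
                                    (u≡b (suc m) (s≤s z≤n) ≤-refl)

rsum-cons : ∀ (u : ℕ → ℤ) {s t} → s ≡ suc t → u s ℤ.+ rsum t u ≡ rsum s u
rsum-cons u {t = t} refl = ℤₚ.+-comm (u (suc t)) (rsum t u)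

rsum-reverse : ∀ (u : ℕ → ℤ) {n} i → i ≤ n → rsum i (λ r → u (suc n ∸ r)) ℤ.+ rsum (n ∸ i) u ≡ rsum n u
rsum-reverse u zero    _    = ℤₚ.+-identityˡ _
rsum-reverse u {n} (suc i) si≤n = begin
    (R ℤ.+ u (n ∸ i)) ℤ.+ rsum (n ∸ suc i) u ≡⟨ ℤₚ.+-assoc R _ _ ⟩
    R ℤ.+ (u (n ∸ i) ℤ.+ rsum (n ∸ suc i) u) ≡⟨ cong (λ x → R ℤ.+ x) (rsum-cons u (n∸i≡suc[n∸suc[i]] si≤n)) ⟩
    R ℤ.+ rsum (n ∸ i) u                     ≡⟨ rsum-reverse u i (≤-trans (n≤1+n i) si≤n) ⟩
    rsum n u                                 ∎
  where
    open ≡-Reasoning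
    R = rsum i (λ r → u (suc n ∸ r))

PartialRowSums : ℕ → Matrix → (ℕ → ℕ → ℕ) → Set
PartialRowSums n B b = ∀ i p → i ≤ n → 1 ≤ p → p ≤ n → partialRowSum B i p ≡ + b i p

module _ {n B b} (sums : PartialRowSums n B b) where

  rsum-partialRowSum : ∀ {i m} → i ≤ n → m ≤ n → rsum m (partialRowSum B i) ≡ + nsum m (b i)
  rsum-partialRowSum i≤n m≤n = rsum≡nsum _ λ p 1≤p p≤m → sums _ p i≤n 1≤p (≤-trans p≤m m≤n)

  corrGog⇒isKth : ∀ {G} → CorrGog n B G → ∀ {i j} → 1 ≤ j → j ≤ i → i ≤ n → IsKth n (b i) j (G i j)
  corrGog⇒isKth gog {i} {j} 1≤j j≤i i≤n with gog i j 1≤j j≤i i≤n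
  ... | 1≤g , g≤n , one , count = record
    { 1≤pos   = 1≤g
    ; pos≤n   = g≤n
    ; isOne   = ℤₚ.+-injective (trans (sym (sums i _ i≤n 1≤g g≤n)) one)
    ; countAt = ℤₚ.+-injective (trans (sym (rsum-partialRowSum i≤n g≤n)) count) }

  isKth⇒corrGog : ∀ {G} → (∀ i j → 1 ≤ j → j ≤ i → i ≤ n → IsKth n (b i) j (G i j)) → CorrGog n B G
  isKth⇒corrGog kth i j 1≤j j≤i i≤n =
    1≤pos , pos≤n , trans (sums i _ i≤n 1≤pos pos≤n) (cong +_ isOne) ,
    trans (rsum-partialRowSum i≤n pos≤n) (cong +_ countAt)
    where open IsKth (kth i j 1≤j j≤i i≤n)

prefixOnes : Matrix → ℕ → ℕ → ℕ
prefixOnes A i p = ∣ partialRowSum A i p ∣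

binary⇒≡+∣∣ : ∀ {x : ℤ} → x ≡ + 0 ⊎ x ≡ + 1 → x ≡ + ∣ x ∣
binary⇒≡+∣∣ (inj₁ refl) = refl
binary⇒≡+∣∣ (inj₂ refl) = refl

binary⇒∣∣≤1 : ∀ {x : ℤ} → x ≡ + 0 ⊎ x ≡ + 1 → ∣ x ∣ ≤ 1
binary⇒∣∣≤1 (inj₁ refl) = z≤n
binary⇒∣∣≤1 (inj₂ refl) = s≤s z≤n

+-≡1⇒≡1∸ : ∀ x {y} → y ≤ 1 → x ℤ.+ + y ≡ + 1 → x ≡ + (1 ∸ y)
+-≡1⇒≡1∸ x {zero}  _ sum≡1 = trans (sym (ℤₚ.+-identityʳ x)) sum≡1
+-≡1⇒≡1∸ x {suc zero} _ sum≡1 = ∙-cancelʳ (+ 1) x (+ 0) sum≡1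
+-≡1⇒≡1∸ x {suc (suc _)} (s≤s ())

module _ {n A} (asm : IsASM n A) where
  open IsASM asm

  partialRowSum-binary : ∀ i p → i ≤ n → 1 ≤ p → p ≤ n → partialRowSum A i p ≡ + 0 ⊎ partialRowSum A i p ≡ + 1
  partialRowSum-binary i p i≤n 1≤p p≤n =
    alternating-prefixSum-binary (λ a b → colAlt p a b 1≤p p≤n) (colSum p 1≤p p≤n) i i≤n

  rowPrefix-binary : ∀ i m → 1 ≤ i → i ≤ n → m ≤ n → rsum m (A i) ≡ + 0 ⊎ rsum m (A i) ≡ + 1
  rowPrefix-binary i m 1≤i i≤n m≤n =
    alternating-prefixSum-binary (λ a b → rowAlt i a b 1≤i i≤n) (rowSum i 1≤i i≤n) m m≤n

  asm-partialRowSums : PartialRowSums n A (prefixOnes A)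
  asm-partialRowSums i p i≤n 1≤p p≤n = binary⇒≡+∣∣ (partialRowSum-binary i p i≤n 1≤p p≤n)

  rsum-partialRowSum-suc : ∀ i m → rsum m (partialRowSum A (suc i)) ≡ rsum m (partialRowSum A i) ℤ.+ rsum m (A (suc i))
  rsum-partialRowSum-suc i m = rsum-+ m (partialRowSum A i) (A (suc i))

  asm-interlacing : Interlacing n (prefixOnes A)
  asm-interlacing = record
    { binary    = λ i i≤n p 1≤p p≤n → binary⇒∣∣≤1 (partialRowSum-binary i p i≤n 1≤p p≤n)
    ; total     = λ i i≤n → ℤₚ.+-injective (trans (sym (rsum-partialRowSum asm-partialRowSums i≤n ≤-refl)) (rowsTotal i i≤n))
    ; interlace = interlace }
    where
      rowsTotal : ∀ i → i ≤ n → rsum n (partialRowSum A i) ≡ + i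
      rowsTotal zero    _    = rsum-const0 n
      rowsTotal (suc i) si≤n = begin
        rsum n (partialRowSum A (suc i))                     ≡⟨ rsum-partialRowSum-suc i n ⟩
        rsum n (partialRowSum A i) ℤ.+ rsum n (A (suc i))    ≡⟨ cong₂ ℤ._+_ (rowsTotal i (≤-trans (n≤1+n i) si≤n)) (rowSum (suc i) (s≤s z≤n) si≤n) ⟩
        + (i + 1)                                            ≡⟨ cong +_ (+-comm i 1) ⟩
        + suc i                                              ∎
        where open ≡-Reasoning
      count-step : ∀ i m → suc i ≤ n → m ≤ n →
                   + nsum m (prefixOnes A (suc i)) ≡ + nsum m (prefixOnes A i) ℤ.+ rsum m (A (suc i))
      count-step i m si≤n m≤n = begin
        + nsum m (prefixOnes A (suc i))                        ≡⟨ rsum-partialRowSum asm-partialRowSums si≤n m≤n ⟨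
        rsum m (partialRowSum A (suc i))                       ≡⟨ rsum-partialRowSum-suc i m ⟩
        rsum m (partialRowSum A i) ℤ.+ rsum m (A (suc i))      ≡⟨ cong (λ x → x ℤ.+ rsum m (A (suc i)))
                                                                     (rsum-partialRowSum asm-partialRowSums (≤-trans (n≤1+n i) si≤n) m≤n) ⟩
        + nsum m (prefixOnes A i) ℤ.+ rsum m (A (suc i))       ∎
        where open ≡-Reasoning
      interlace : ∀ i m → suc i ≤ n → m ≤ n →
                  nsum m (prefixOnes A (suc i)) ≡ nsum m (prefixOnes A i) ⊎
                  nsum m (prefixOnes A (suc i)) ≡ suc (nsum m (prefixOnes A i))
      interlace i m si≤n m≤n with rowPrefix-binary (suc i) m (s≤s z≤n) si≤n m≤n
      ... | inj₁ row≡0 = inj₁ (ℤₚ.+-injective (trans (count-step i m si≤n m≤n)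
                           (trans (cong (λ x → + nsum m (prefixOnes A i) ℤ.+ x) row≡0) (ℤₚ.+-identityʳ _))))
      ... | inj₂ row≡1 = inj₂ (ℤₚ.+-injective (trans (count-step i m si≤n m≤n)
                           (trans (cong (λ x → + nsum m (prefixOnes A i) ℤ.+ x) row≡1) (cong +_ (+-comm _ 1)))))

  revRows-partialRowSums : PartialRowSums n (revRows n A) (complement n (prefixOnes A))
  revRows-partialRowSums i p i≤n 1≤p p≤n =
    +-≡1⇒≡1∸ _ (Interlacing.binary asm-interlacing (n ∸ i) n∸i≤n p 1≤p p≤n) (begin
      partialRowSum (revRows n A) i p ℤ.+ + prefixOnes A (n ∸ i) p
        ≡⟨ cong (λ x → partialRowSum (revRows n A) i p ℤ.+ x) (asm-partialRowSums (n ∸ i) p n∸i≤n 1≤p p≤n) ⟨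
      partialRowSum (revRows n A) i p ℤ.+ partialRowSum A (n ∸ i) p
        ≡⟨ rsum-reverse (λ r → A r p) i i≤n ⟩
      rsum n (λ r → A r p)
        ≡⟨ colSum p 1≤p p≤n ⟩
      + 1 ∎)
    where
      open ≡-Reasoning
      n∸i≤n = m∸n≤m n i

colour-swap : ∀ {a b c d} → (c ≤ d → ¬ a ≤ b) → (¬ c ≤ d → a ≤ b) →
  (if a ≤ᵇ b then white else gray) ≡ swapColor (if c ≤ᵇ d then white else gray)
colour-swap {a} {b} {c} {d} excl cover with c ≤ᵇ d | ≤ᵇ-reflects-≤ c d | a ≤ᵇ b | ≤ᵇ-reflects-≤ a b
... | true  | ofʸ c≤d | true  | ofʸ a≤b = contradiction a≤b (excl c≤d)
... | true  | _       | false | _       = refl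
... | false | _       | true  | _       = refl
... | false | ofⁿ c≰d | false | ofⁿ a≰b = contradiction (cover c≰d) a≰b

colour-injective : ∀ {x y : Bool} → (if x then white else gray) ≡ (if y then white else gray) → x ≡ y
colour-injective {true}  {true}  _ = refl
colour-injective {false} {false} _ = refl

≤ᵇ-agree⇒≤ : ∀ {u v N} → v ≤ N → (∀ j → 1 ≤ j → j ≤ N → (j ≤ᵇ v) ≡ (j ≤ᵇ u)) → v ≤ u
≤ᵇ-agree⇒≤ {v = zero}  _     _     = z≤n
≤ᵇ-agree⇒≤ {u} {suc v} sv≤N agree = ≤ᵇ⇒≤ (suc v) u (subst T (agree (suc v) (s≤s z≤n) sv≤N) (≤⇒≤ᵇ (≤-refl {suc v})))

≤ᵇ-extensional : ∀ {x y N} → x ≤ N → y ≤ N → (∀ j → 1 ≤ j → j ≤ N → (j ≤ᵇ x) ≡ (j ≤ᵇ y)) → x ≡ y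
≤ᵇ-extensional x≤N y≤N agree =
  ≤-antisym (≤ᵇ-agree⇒≤ x≤N agree) (≤ᵇ-agree⇒≤ y≤N λ j 1≤j j≤N → sym (agree j 1≤j j≤N))

+≡+⇒<⇒< : ∀ {x y a b} → x + y ≡ a + b → x < b → a < y
+≡+⇒<⇒< {x} {y} {a} {b} x+y≡a+b x<b = ≰⇒> λ y≤a →
  <-irrefl x+y≡a+b (subst (x + y <_) (+-comm b a) (+-mono-<-≤ x<b y≤a))

+≡+⇒≤⇒≤ : ∀ {x y a b} → x + y ≡ a + b → b ≤ x → y ≤ a
+≡+⇒≤⇒≤ {x} {y} {a} {b} x+y≡a+b b≤x = ≮⇒≥ λ a<y →
  <-irrefl (trans (+-comm b a) (sym x+y≡a+b)) (+-mono-≤-< b≤x a<y)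

kth-complement : ∀ {n c c' j₀ k g g'} → IsKth n c (suc j₀) g → IsKth n c' k g' →
  nsum (j₀ + k) c' + nsum (j₀ + k) c ≡ j₀ + k →
  (j₀ + k < g' → g ≤ j₀ + k) × (g ≤ j₀ + k → j₀ + k < g')
kth-complement P P' sum≡ =
  (λ m<g' → isKth-≤nsum⇒≤ P (+≡+⇒<⇒< sum≡ (≰⇒> λ k≤ → <⇒≱ m<g' (isKth-≤nsum⇒≤ P' k≤)))) ,
  (λ g≤m → ≰⇒> λ g'≤m → <⇒≱ (isKth-≤⇒≤nsum P g≤m) (+≡+⇒≤⇒≤ sum≡ (isKth-≤⇒≤nsum P' g'≤m)))

complement-pyrSwap : ∀ {n b} {O G : Triangle} → Interlacing n b →
  (∀ i j → 1 ≤ j → j ≤ i → i ≤ n → IsKth n (b i) j (G i j)) →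
  (∀ i j → 1 ≤ j → j ≤ i → i ≤ n ∸ 1 → O i j ≡ G i j ∸ j) →
  PyrSwap n O (ogogOf n (complement n b))
complement-pyrSwap {n} {b} {O} {G} I kthG O≡G∸j i (suc j₀) k 1≤j j≤i i≤n-1 1≤k k≤n∸i
  rewrite O≡G∸j i (suc j₀) 1≤j j≤i i≤n-1 = colour-swap white⇒gray gray⇒white
  where
    j = suc j₀
    m = j₀ + k
    i≤n = ≤∸1⇒≤ i≤n-1
    m≤n : m ≤ n
    m≤n = <⇒≤ (≤-trans (+-mono-≤ j≤i k≤n∸i) (≤-reflexive (m+[n∸m]≡n i≤n)))
    I' = interlacing-complement I
    g = G i j
    g' = gogOf n (complement n b) (n ∸ i) k
    P = kthG i j 1≤j j≤i i≤n
    P' = gogOf-isKth I' 1≤k k≤n∸i (m∸n≤m n i)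
    sum≡ : nsum m (complement n b (n ∸ i)) + nsum m (b i) ≡ m
    sum≡ = subst (λ s → nsum m (complement n b (n ∸ i)) + nsum m (b s) ≡ m) (m∸[m∸n]≡n i≤n)
             (nsum-complement-+ I (n ∸ i) m (m∸n≤m n i) m≤n)
    j≤g : j ≤ g
    j≤g = subst (_≤ g) (IsKth.countAt P) (nsum-≤ (Interlacing.binary I i i≤n) (IsKth.pos≤n P))
    k≤g' : k ≤ g'
    k≤g' = subst (_≤ g') (IsKth.countAt P') (nsum-≤ (Interlacing.binary I' (n ∸ i) (m∸n≤m n i)) (IsKth.pos≤n P'))
    k+j≡sm : k + j ≡ suc m
    k+j≡sm = trans (+-suc k j₀) (cong suc (+-comm k j₀))
    white⇒gray : k ≤ g ∸ j → ¬ j ≤ g' ∸ k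
    white⇒gray k≤g∸j j≤g'∸k = <⇒≱ (subst (_≤ g) k+j≡sm (m≤o∸n⇒m+n≤o k j≤g k≤g∸j))
                                  (proj₁ (kth-complement P P' sum≡) (m≤o∸n⇒m+n≤o j k≤g' j≤g'∸k))
    gray⇒white : ¬ k ≤ g ∸ j → j ≤ g' ∸ k
    gray⇒white k≰g∸j = m+n≤o⇒m≤o∸n j (proj₂ (kth-complement P P' sum≡)
                          (≮⇒≥ λ m<g → k≰g∸j (m+n≤o⇒m≤o∸n k (subst (_≤ g) (sym k+j≡sm) m<g))))

pyrSwap-unique : ∀ {n O H H'} → IsOgog n H → IsOgog n H' → PyrSwap n O H → PyrSwap n O H' →
  ∀ i k → 1 ≤ k → k ≤ i → i ≤ n ∸ 1 → H i k ≡ H' i k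
pyrSwap-unique {n} {O} {H} {H'} ogH ogH' swapH swapH' i k 1≤k k≤i i≤n-1 =
  ≤ᵇ-extensional (IsOgog.bound ogH i k 1≤k k≤i i≤n-1) (IsOgog.bound ogH' i k 1≤k k≤i i≤n-1) agree
  where
    i≤n = ≤∸1⇒≤ i≤n-1
    n∸[n∸i]≡i = m∸[m∸n]≡n i≤n
    agree : ∀ j → 1 ≤ j → j ≤ n ∸ i → (j ≤ᵇ H i k) ≡ (j ≤ᵇ H' i k)
    agree j 1≤j j≤n∸i = colour-injective (subst (λ s → pyrColor H s k j ≡ pyrColor H' s k j) n∸[n∸i]≡i
      (trans (swapH (n ∸ i) j k 1≤j j≤n∸i n∸i≤n∸1 1≤k k≤n∸[n∸i])
             (sym (swapH' (n ∸ i) j k 1≤j j≤n∸i n∸i≤n∸1 1≤k k≤n∸[n∸i]))))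
      where
        n∸i≤n∸1 = ∸-monoʳ-≤ n (≤-trans 1≤k k≤i)
        k≤n∸[n∸i] = subst (k ≤_) (sym n∸[n∸i]≡i) k≤i

mainTheorem8 : (n : ℕ) → 2 ≤ n → (A : Matrix) → IsASM n A →
    (O : Triangle) → CorrOgog n A O →
    (Σ Triangle λ H → IsOgog n H × PyrSwap n O H) ×
    ((H : Triangle) → IsOgog n H → PyrSwap n O H → CorrOgog n (revRows n A) H)
mainTheorem8 n _ A asm O (G , gog , O≡G∸j) =
  (ogogOf n b' , isOgog , swap) ,
  λ H ogH swapH → gogOf n b' ,
    isKth⇒corrGog (revRows-partialRowSums asm) (λ _ _ → gogOf-isKth reversed) ,
    λ i k 1≤k k≤i i≤n-1 → pyrSwap-unique ogH isOgog swapH swap i k 1≤k k≤i i≤n-1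
  where
    b' = complement n (prefixOnes A)
    reversed = interlacing-complement (asm-interlacing asm)
    isOgog = interlacing-isOgog reversed
    swap = complement-pyrSwap {G = G} (asm-interlacing asm)
             (λ _ _ → corrGog⇒isKth (asm-partialRowSums asm) gog) O≡G∸j
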